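{- There exists a $12\times 11$ binary $3$-covering array, and any two $12\times 11$ binary $3$-covering arrays are equivalent.
   Context: A binary $t$-covering array of size $m$ and degree $n$ is an $m\times n$ matrix with entries in $\{0,1\}$ such that for any $t$ distinct columns, all $2^t$ binary vectors of length $t$ occur at least once as the restriction of some row to those columns. Two binary matrices are equivalent if one can be transformed into the other by a sequence of row permutations, column permutations, and complementations of individual columns (swapping $0$ and $1$ in that column). -}

module Defs where

open import Data.Nat using (ℕ)
open import Data.Fin using (Fin)
open import Data.Bool using (Bool; not)
open import Data.Product using (∃; _×_)
open import Relation.Binary.PropositionalEquality using (_≡_)
open import Data.Fin.Permutation using (Permutation′; _⟨$⟩ʳ_)
open import Function.Definitions using (Injective)
open import Relation.Nullary using (yes; no)
open import Data.Fin using (_≟_)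

BinMatrix : ℕ → ℕ → Set
BinMatrix m n = Fin m → Fin n → Bool

-- t-covering array: for every choice of t distinct columns
-- (an injective map c : Fin t → Fin n) and every binary vector v of
-- length t, some row restricted to those columns equals v.
IsCoveringArray : (t m n : ℕ) → BinMatrix m n → Set
IsCoveringArray t m n A =
  (c : Fin t → Fin n) → Injective _≡_ _≡_ c →
  (v : Fin t → Bool) → ∃ λ (r : Fin m) → (k : Fin t) → A r (c k) ≡ v k

permuteRows : ∀ {m n} → Permutation′ m → BinMatrix m n → BinMatrix m n
permuteRows σ A i j = A (σ ⟨$⟩ʳ i) j

permuteCols : ∀ {m n} → Permutation′ n → BinMatrix m n → BinMatrix m n
permuteCols τ A i j = A i (τ ⟨$⟩ʳ j)

complementCol : ∀ {m n} → Fin n → BinMatrix m n → BinMatrix m n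
complementCol j₀ A i j with j ≟ j₀
... | yes _ = not (A i j)
... | no _  = A i j

data Step {m n : ℕ} : BinMatrix m n → BinMatrix m n → Set where
  rowPerm : ∀ A (σ : Permutation′ m) → Step A (permuteRows σ A)
  colPerm : ∀ A (τ : Permutation′ n) → Step A (permuteCols τ A)
  colComp : ∀ A (j : Fin n) → Step A (complementCol j A)

-- Equivalence: reachable by a finite sequence of elementary steps.
-- Matrices are compared pointwise (functions, no funext).
data Equivalent {m n : ℕ} : BinMatrix m n → BinMatrix m n → Set where
  done : ∀ {A B} → (∀ i j → A i j ≡ B i j) → Equivalent A B
  step : ∀ {A B C} → Step A B → Equivalent B C → Equivalent A C

module Submission where

-- Every matrix is equivalent to a normalised one: first row zero, rows and
-- columns in ascending order of their binary values (NormalForm; bubble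
-- sort terminates because each swap lowers the value of the whole matrix
-- read as one binary number, which can be computed by rows or by columns).
-- In a 12 × 11 3-covering array each column contains each bit at most six
-- times (ColumnBalance: otherwise the other columns, restricted to the rows
-- with a fixed bit in that column, would give five pairwise qualitatively
-- independent words of length at most five, which a search rules out).  A
-- backtracking search over normalised boards, pruned by tests that every
-- normalised 3-covering array passes, finds exactly two completions S₁ and
-- S₂ (Search, SearchSoundness).  Finally S₂ is carried to S₁ by explicit
-- moves and S₁ is checked to be a 3-covering array.

open import Defs
open import Data.Product using (∃; _×_)

module BooleanTests where

  open import Data.Fin using (Fin)
  open import Data.Bool using (Bool; true; false; T; not; _∧_)
  open import Data.Bool.Properties using (T-∧)
  open import Data.Bool.ListAction using (all; any)
  open import Data.List using (allFin)
  open import Data.List.Membership.Propositional using (_∈_)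
  open import Data.List.Membership.Propositional.Properties using (∈-allFin)
  open import Data.List.Relation.Unary.All as All using (All)
  open import Data.List.Relation.Unary.All.Properties using (all⁺; all⁻)
  open import Data.List.Relation.Unary.Any using (satisfied)
  open import Data.List.Relation.Unary.Any.Properties using (any⁻)
  open import Data.Product using (∃; _×_; _,_; proj₁; proj₂)
  open import Function using (Equivalence)
  open import Relation.Binary.PropositionalEquality using (_≡_; refl)
  open import Relation.Nullary using (¬_)

  _==_ : Bool → Bool → Bool
  true  == true  = true
  false == false = true
  _     == _     = false

  ==-refl : ∀ x → T (x == x)
  ==-refl true  = _
  ==-refl false = _

  ==-reflexive : ∀ {x y} → x ≡ y → T (x == y)
  ==-reflexive {x} refl = ==-refl x

  ==-sound : ∀ {x y} → T (x == y) → x ≡ y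
  ==-sound {true}  {true}  _ = refl
  ==-sound {false} {false} _ = refl

  ∧-intro : ∀ {x y} → T x → T y → T (x ∧ y)
  ∧-intro tx ty = Equivalence.from T-∧ (tx , ty)

  ∧-elim : ∀ {x y} → T (x ∧ y) → T x × T y
  ∧-elim = Equivalence.to T-∧

  all-sound : ∀ {A : Set} (p : A → Bool) {xs x} → T (all p xs) → x ∈ xs → T (p x)
  all-sound p {xs} ok = All.lookup (all⁺ p xs ok)

  all-intro : ∀ {A : Set} (p : A → Bool) {xs} → (∀ {x} → x ∈ xs → T (p x)) → T (all p xs)
  all-intro p h = all⁻ p (All.tabulate h)

  forAllFin : ∀ {n} → (Fin n → Bool) → Bool
  forAllFin {n} p = all p (allFin n)

  forAllFin-sound : ∀ {n} (p : Fin n → Bool) → T (forAllFin p) → ∀ k → T (p k)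
  forAllFin-sound p ok k = all-sound p ok (∈-allFin k)

  existsFin : ∀ {n} → (Fin n → Bool) → Bool
  existsFin {n} p = any p (allFin n)

  existsFin-sound : ∀ {n} (p : Fin n → Bool) → T (existsFin p) → ∃ λ k → T (p k)
  existsFin-sound {n} p ok = satisfied (any⁻ p (allFin n) ok)

  forBits : (Bool → Bool) → Bool
  forBits p = p true ∧ p false

  forBits-sound : ∀ (p : Bool → Bool) → T (forBits p) → ∀ x → T (p x)
  forBits-sound p ok true  = proj₁ (∧-elim ok)
  forBits-sound p ok false = proj₂ (∧-elim {p true} ok)

  T-not : ∀ {x} → T (not x) → ¬ T x
  T-not {false} _ ()

  -- Facts established by evaluation are stated as 'b ≡ true': a type 'T b'
  -- may be unfolded, i.e. b re-evaluated, whenever two such types are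
  -- compared.  These convert between the two forms.
  ≡true⇒T : ∀ {x} → x ≡ true → T x
  ≡true⇒T refl = _

  T⇒≡true : ∀ {x} → T x → x ≡ true
  T⇒≡true {true} _ = refl

module MatrixEquivalence where

  open BooleanTests
  open import Data.Fin using (Fin; _≟_)
  open import Data.Bool using (Bool; T; _xor_)
  open import Data.Bool.Properties using (xor-assoc; xor-same)
  open import Data.Product using (∃; _×_; _,_)
  open import Data.Fin.Permutation using (_⟨$⟩ʳ_; _⟨$⟩ˡ_; inverseʳ; inverseˡ; flip)
  open import Relation.Nullary using (yes; no; does)
  open import Relation.Binary.PropositionalEquality
  open import Function using (_∘′_)

  -- Pointwise equality of matrices; 'Equivalent' ends in it (there is no
  -- function extensionality).
  _≋_ : ∀ {m n} → BinMatrix m n → BinMatrix m n → Set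
  A ≋ B = ∀ i j → A i j ≡ B i j

  _≋ᵇ_ : ∀ {m n} → BinMatrix m n → BinMatrix m n → Bool
  A ≋ᵇ B = forAllFin λ i → forAllFin λ j → A i j == B i j

  ≋ᵇ-sound : ∀ {m n} (A B : BinMatrix m n) → T (A ≋ᵇ B) → A ≋ B
  ≋ᵇ-sound A B same i j =
    ==-sound (forAllFin-sound (λ j → A i j == B i j)
               (forAllFin-sound (λ i → forAllFin λ j → A i j == B i j) same i) j)

  ≋-sym : ∀ {m n} {A B : BinMatrix m n} → A ≋ B → B ≋ A
  ≋-sym A≋B i j = sym (A≋B i j)

  ≋-trans : ∀ {m n} {A B C : BinMatrix m n} → A ≋ B → B ≋ C → A ≋ C
  ≋-trans A≋B B≋C i j = trans (A≋B i j) (B≋C i j)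

  complementCol-xor : ∀ {m n} (j₀ : Fin n) (A : BinMatrix m n) i j →
    complementCol j₀ A i j ≡ does (j ≟ j₀) xor A i j
  complementCol-xor j₀ A i j with j ≟ j₀
  ... | yes _ = refl
  ... | no _  = refl

  xor-cancel : ∀ b x → b xor (b xor x) ≡ x
  xor-cancel b x = trans (sym (xor-assoc b b x)) (cong (_xor x) (xor-same b))

  complementCol-involutive : ∀ {m n} (j₀ : Fin n) (A : BinMatrix m n) →
    complementCol j₀ (complementCol j₀ A) ≋ A
  complementCol-involutive j₀ A i j = begin
    complementCol j₀ (complementCol j₀ A) i j  ≡⟨ complementCol-xor j₀ _ i j ⟩
    d xor complementCol j₀ A i j               ≡⟨ cong (d xor_) (complementCol-xor j₀ A i j) ⟩
    d xor (d xor A i j)                        ≡⟨ xor-cancel d (A i j) ⟩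
    A i j                                      ∎
    where
    open ≡-Reasoning
    d : Bool
    d = does (j ≟ j₀)

  complementCol-cong : ∀ {m n} (j₀ : Fin n) {A B : BinMatrix m n} → A ≋ B →
    complementCol j₀ A ≋ complementCol j₀ B
  complementCol-cong j₀ {A} {B} A≋B i j = begin
    complementCol j₀ A i j   ≡⟨ complementCol-xor j₀ A i j ⟩
    does (j ≟ j₀) xor A i j  ≡⟨ cong (does (j ≟ j₀) xor_) (A≋B i j) ⟩
    does (j ≟ j₀) xor B i j  ≡⟨ complementCol-xor j₀ B i j ⟨
    complementCol j₀ B i j   ∎
    where open ≡-Reasoning

  Step-resp-≋ : ∀ {m n} {A A′ B : BinMatrix m n} → A ≋ A′ → Step A B →
    ∃ λ B′ → Step A′ B′ × B ≋ B′
  Step-resp-≋ {A′ = A′} A≋A′ (rowPerm A σ) = _ , rowPerm A′ σ , λ i j → A≋A′ _ j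
  Step-resp-≋ {A′ = A′} A≋A′ (colPerm A τ) = _ , colPerm A′ τ , λ i j → A≋A′ i _
  Step-resp-≋ {A′ = A′} A≋A′ (colComp A j) = _ , colComp A′ j , complementCol-cong j A≋A′

  ~-respˡ-≋ : ∀ {m n} {A A′ C : BinMatrix m n} → A ≋ A′ → Equivalent A C → Equivalent A′ C
  ~-respˡ-≋ A≋A′ (done A≋C) = done (≋-trans (≋-sym A≋A′) A≋C)
  ~-respˡ-≋ A≋A′ (step s B~C) with Step-resp-≋ A≋A′ s
  ... | _ , s′ , B≋B′ = step s′ (~-respˡ-≋ B≋B′ B~C)

  ~-refl : ∀ {m n} {A : BinMatrix m n} → Equivalent A A
  ~-refl = done (λ i j → refl)

  ~-trans : ∀ {m n} {A B C : BinMatrix m n} → Equivalent A B → Equivalent B C → Equivalent A C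
  ~-trans (done A≋B)   B~C = ~-respˡ-≋ (≋-sym A≋B) B~C
  ~-trans (step s A~B) B~C = step s (~-trans A~B B~C)

  Step-inverse : ∀ {m n} {A B : BinMatrix m n} → Step A B → Equivalent B A
  Step-inverse (rowPerm A σ)  = step (rowPerm _ (flip σ)) (done λ i j → cong (λ r → A r j) (inverseʳ σ))
  Step-inverse (colPerm A τ)  = step (colPerm _ (flip τ)) (done λ i j → cong (A i) (inverseʳ τ))
  Step-inverse (colComp A j₀) = step (colComp _ j₀) (done (complementCol-involutive j₀ A))

  ~-sym : ∀ {m n} {A B : BinMatrix m n} → Equivalent A B → Equivalent B A
  ~-sym (done A≋B)   = done (≋-sym A≋B)
  ~-sym (step s B~C) = ~-trans (~-sym B~C) (Step-inverse s)

  CA-resp-≋ : ∀ {t m n} {A B : BinMatrix m n} → A ≋ B →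
    IsCoveringArray t m n A → IsCoveringArray t m n B
  CA-resp-≋ A≋B caA c c-inj v with caA c c-inj v
  ... | r , hit = r , λ k → trans (sym (A≋B r (c k))) (hit k)

  CA-Step : ∀ {t m n} {A B : BinMatrix m n} → Step A B →
    IsCoveringArray t m n A → IsCoveringArray t m n B
  CA-Step (rowPerm A σ) caA c c-inj v with caA c c-inj v
  ... | r , hit = flip σ ⟨$⟩ʳ r , λ k → trans (cong (λ r′ → A r′ (c k)) (inverseʳ σ)) (hit k)
  CA-Step (colPerm A τ) caA c c-inj v = caA (λ k → τ ⟨$⟩ʳ c k) τc-inj v
    where
    τc-inj : ∀ {k l} → τ ⟨$⟩ʳ c k ≡ τ ⟨$⟩ʳ c l → k ≡ l
    τc-inj {k} {l} e = c-inj (trans (sym (inverseˡ τ)) (trans (cong (τ ⟨$⟩ˡ_) e) (inverseˡ τ)))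
  CA-Step (colComp A j₀) caA c c-inj v with caA c c-inj (λ k → does (c k ≟ j₀) xor v k)
  ... | r , hit = r , λ k → begin
    complementCol j₀ A r (c k)            ≡⟨ complementCol-xor j₀ A r (c k) ⟩
    does (c k ≟ j₀) xor A r (c k)         ≡⟨ cong (does (c k ≟ j₀) xor_) (hit k) ⟩
    does (c k ≟ j₀) xor (does (c k ≟ j₀) xor v k) ≡⟨ xor-cancel (does (c k ≟ j₀)) (v k) ⟩
    v k                                   ∎
    where open ≡-Reasoning

  CA-resp-~ : ∀ {t m n} {A B : BinMatrix m n} → Equivalent A B →
    IsCoveringArray t m n A → IsCoveringArray t m n B
  CA-resp-~ (done A≋B)   = CA-resp-≋ A≋B
  CA-resp-~ (step s B~C) = CA-resp-~ B~C ∘′ CA-Step s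

module ThreeColumns where

  open import Data.Nat using (suc)
  open import Data.Fin using (Fin; zero; suc; punchIn; punchOut)
  open import Data.Fin.Properties using (punchIn-injective; punchInᵢ≢i; punchIn-punchOut)
  open import Data.Bool using (false)
  open import Data.Product using (∃; _×_; _,_)
  open import Data.Empty using (⊥-elim)
  open import Function using (_∘_)
  open import Function.Definitions using (Injective)
  open import Relation.Nullary using (¬_)
  open import Relation.Binary.PropositionalEquality

  ⟨_,_,_⟩ : ∀ {A : Set} → A → A → A → Fin 3 → A
  ⟨ a , b , c ⟩ zero             = a
  ⟨ a , b , c ⟩ (suc zero)       = b
  ⟨ a , b , c ⟩ (suc (suc zero)) = c

  ⟨,,⟩-injective : ∀ {n} {a b c : Fin n} → ¬ a ≡ b → ¬ a ≡ c → ¬ b ≡ c →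
    Injective _≡_ _≡_ ⟨ a , b , c ⟩
  ⟨,,⟩-injective a≢b a≢c b≢c {zero}             {zero}             _ = refl
  ⟨,,⟩-injective a≢b a≢c b≢c {zero}             {suc zero}         e = ⊥-elim (a≢b e)
  ⟨,,⟩-injective a≢b a≢c b≢c {zero}             {suc (suc zero)}   e = ⊥-elim (a≢c e)
  ⟨,,⟩-injective a≢b a≢c b≢c {suc zero}         {zero}             e = ⊥-elim (a≢b (sym e))
  ⟨,,⟩-injective a≢b a≢c b≢c {suc zero}         {suc zero}         _ = refl
  ⟨,,⟩-injective a≢b a≢c b≢c {suc zero}         {suc (suc zero)}   e = ⊥-elim (b≢c e)
  ⟨,,⟩-injective a≢b a≢c b≢c {suc (suc zero)}   {zero}             e = ⊥-elim (a≢c (sym e))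
  ⟨,,⟩-injective a≢b a≢c b≢c {suc (suc zero)}   {suc zero}         e = ⊥-elim (b≢c (sym e))
  ⟨,,⟩-injective a≢b a≢c b≢c {suc (suc zero)}   {suc (suc zero)}   _ = refl

  covers3 : ∀ {m n} {A : BinMatrix m n} → IsCoveringArray 3 m n A →
    ∀ {a b c} → ¬ a ≡ b → ¬ a ≡ c → ¬ b ≡ c → ∀ x y z →
    ∃ λ r → A r a ≡ x × A r b ≡ y × A r c ≡ z
  covers3 ca a≢b a≢c b≢c x y z with ca _ (⟨,,⟩-injective a≢b a≢c b≢c) ⟨ x , y , z ⟩
  ... | r , hit = r , hit zero , hit (suc zero) , hit (suc (suc zero))

  covers3-intro : ∀ {m n} {A : BinMatrix m n} →
    (∀ {a b c} → ¬ a ≡ b → ¬ a ≡ c → ¬ b ≡ c → ∀ x y z → ∃ λ r → A r a ≡ x × A r b ≡ y × A r c ≡ z) →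
    IsCoveringArray 3 m n A
  covers3-intro covered c c-inj v =
    let r , ra , rb , rc = covered (λ e → 0≢1 (c-inj e)) (λ e → 0≢2 (c-inj e)) (λ e → 1≢2 (c-inj e))
                                   (v zero) (v (suc zero)) (v (suc (suc zero)))
    in r , λ { zero → ra ; (suc zero) → rb ; (suc (suc zero)) → rc }
    where
    0≢1 : ¬ zero ≡ suc zero
    0≢1 ()
    0≢2 : ¬ zero ≡ suc (suc zero)
    0≢2 ()
    1≢2 : ¬ suc zero ≡ suc (suc zero)
    1≢2 ()

  thirdColumn : ∀ {n} {a b : Fin (suc (suc (suc n)))} → ¬ a ≡ b → ∃ λ d → ¬ a ≡ d × ¬ b ≡ d
  thirdColumn {n} {a} {b} a≢b = punchIn a d′ , punchInᵢ≢i a d′ ∘ sym , b≢d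
    where
    b′ d′ : Fin (suc (suc n))
    b′ = punchOut a≢b
    d′ = punchIn b′ zero
    b≢d : ¬ b ≡ punchIn a d′
    b≢d b≡d = punchInᵢ≢i b′ zero (sym (punchIn-injective a b′ d′ (trans (punchIn-punchOut a≢b) b≡d)))

  covers2 : ∀ {m n} {A : BinMatrix m (suc (suc (suc n)))} → IsCoveringArray 3 m (suc (suc (suc n))) A →
    ∀ {a b} → ¬ a ≡ b → ∀ x y → ∃ λ r → A r a ≡ x × A r b ≡ y
  covers2 {A = A} ca a≢b x y with thirdColumn a≢b
  ... | d , a≢d , b≢d with covers3 {A = A} ca a≢b a≢d b≢d x y false
  ...   | r , ra , rb , _ = r , ra , rb

module BinaryValues where

  open import Data.Nat hiding (_≟_)
  open import Data.Nat.Properties hiding (_≟_; suc-injective)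
  open import Function using (_∘_; _∘′_)
  open import Data.Fin using (Fin; zero; suc; toℕ; inject₁; _≟_)
  open import Data.Fin.Properties using (toℕ-inject₁; toℕ<n; suc-injective)
  import Data.Fin.Permutation.Components as PC
  open import Data.Bool using (Bool; true; false)
  open import Data.Product using (_,_)
  open import Data.Empty using (⊥-elim)
  open import Relation.Nullary using (yes; no; ¬_)
  open import Relation.Binary.PropositionalEquality
  open import Algebra.Properties.Semiring.Sum +-*-semiring
    using (sum; sum-syntax; ∑-comm; *-distribˡ-sum; sum-cong-≗)
  open import Data.Nat.Solver using (module +-*-Solver)
  open +-*-Solver using (solve; _:+_; _:*_; _:=_; con)

  bit : Bool → ℕ
  bit true  = 1
  bit false = 0

  -- Positional weights of a binary word of length n, most significant first.
  weight : ∀ n → Fin n → ℕ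
  weight n k = 2 ^ (n ∸ suc (toℕ k))

  value : ∀ n → (Fin n → Bool) → ℕ
  value n f = ∑[ k < n ] (weight n k * bit (f k))

  rowValue : ∀ {m n} → (Fin m → Fin n → Bool) → Fin m → ℕ
  rowValue {n = n} A i = value n (A i)

  colValue : ∀ {m n} → (Fin m → Fin n → Bool) → Fin n → ℕ
  colValue {m = m} A j = value m (λ i → A i j)

  -- The potential of a matrix: the value of its m·n-bit reading, which can
  -- be computed row by row or column by column.
  rowPotential : ∀ {m n} → (Fin m → Fin n → Bool) → ℕ
  rowPotential {m} A = ∑[ i < m ] (weight m i * rowValue A i)

  colPotential : ∀ {m n} → (Fin m → Fin n → Bool) → ℕ
  colPotential {n = n} A = ∑[ j < n ] (weight n j * colValue A j)

  rowPotential≡colPotential : ∀ {m n} (A : Fin m → Fin n → Bool) → rowPotential A ≡ colPotential A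
  rowPotential≡colPotential {m} {n} A = begin
    ∑[ i < m ] (weight m i * ∑[ j < n ] (weight n j * bit (A i j)))
      ≡⟨ sum-cong-≗ {m} (λ i → *-distribˡ-sum {n} (weight m i) (λ j → weight n j * bit (A i j))) ⟩
    ∑[ i < m ] ∑[ j < n ] (weight m i * (weight n j * bit (A i j)))
      ≡⟨ ∑-comm (λ i j → weight m i * (weight n j * bit (A i j))) ⟩
    ∑[ j < n ] ∑[ i < m ] (weight m i * (weight n j * bit (A i j)))
      ≡⟨ sum-cong-≗ {n} (λ j → sum-cong-≗ {m} (λ i → *-left-commute (weight m i) (weight n j) _)) ⟩
    ∑[ j < n ] ∑[ i < m ] (weight n j * (weight m i * bit (A i j)))
      ≡⟨ sum-cong-≗ {n} (λ j → *-distribˡ-sum {m} (weight n j) (λ i → weight m i * bit (A i j))) ⟨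
    ∑[ j < n ] (weight n j * ∑[ i < m ] (weight m i * bit (A i j)))
      ∎
    where
    open ≡-Reasoning
    *-left-commute : ∀ x y z → x * (y * z) ≡ y * (x * z)
    *-left-commute = solve 3 (λ x y z → x :* (y :* z) := y :* (x :* z)) refl

  value-bound : ∀ n (f : Fin n → Bool) → value n f < 2 ^ n
  value-bound zero    f = s≤s z≤n
  value-bound (suc n) f = begin-strict
    2 ^ n * bit (f zero) + value n (f ∘ suc) <⟨ +-mono-≤-< (*-monoʳ-≤ (2 ^ n) (bit≤1 (f zero)))
                                                          (value-bound n (f ∘ suc)) ⟩
    2 ^ n * 1 + 2 ^ n                        ≡⟨ cong (_+ 2 ^ n) (*-identityʳ (2 ^ n)) ⟩
    2 ^ n + 2 ^ n                            ≡⟨ cong (2 ^ n +_) (sym (+-identityʳ (2 ^ n))) ⟩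
    2 ^ suc n                                ∎
    where
    open ≤-Reasoning
    bit≤1 : ∀ b → bit b ≤ 1
    bit≤1 true  = s≤s z≤n
    bit≤1 false = z≤n

  leading-bit : ∀ n (f g : Fin (suc n) → Bool) → f zero ≡ true → g zero ≡ false →
    value (suc n) g < value (suc n) f
  leading-bit n f g f₀ g₀ rewrite f₀ | g₀ = begin-strict
    2 ^ n * 0 + value n (g ∘ suc)  ≡⟨ cong (_+ value n (g ∘ suc)) (*-zeroʳ (2 ^ n)) ⟩
    value n (g ∘ suc)              <⟨ value-bound n (g ∘ suc) ⟩
    2 ^ n                          ≡⟨ *-identityʳ (2 ^ n) ⟨
    2 ^ n * 1                      ≤⟨ m≤m+n (2 ^ n * 1) (value n (f ∘ suc)) ⟩
    2 ^ n * 1 + value n (f ∘ suc)  ∎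
    where open ≤-Reasoning

  tail-≤ : ∀ n (f g : Fin (suc n) → Bool) → f zero ≡ g zero →
    value (suc n) f ≤ value (suc n) g → value n (f ∘ suc) ≤ value n (g ∘ suc)
  tail-≤ n f g f₀≡g₀ f≤g = +-cancelˡ-≤ (2 ^ n * bit (f zero)) _ _
    (subst (λ b → value (suc n) f ≤ 2 ^ n * bit b + value n (g ∘ suc)) (sym f₀≡g₀) f≤g)

  weight-decreasing : ∀ n (i : Fin n) → weight (suc n) (suc i) < weight (suc n) (inject₁ i)
  weight-decreasing n i rewrite toℕ-inject₁ i =
    ^-monoʳ-< 2 (s≤s (s≤s z≤n)) (∸-monoʳ-< (n<1+n (toℕ i)) (toℕ<n i))

  rearrangement : ∀ W₁ W₂ a b → W₂ < W₁ → b < a → W₁ * b + W₂ * a < W₁ * a + W₂ * b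
  rearrangement W₁ W₂ a b W₂<W₁ b<a with m≤n⇒∃[o]m+o≡n W₂<W₁ | m≤n⇒∃[o]m+o≡n b<a
  ... | d , refl | e , refl =
    subst (L <_) (sym (identity W₂ b d e)) (m<m+n L {suc (d + e + d * e)} z<s)
    where
    L : ℕ
    L = (suc W₂ + d) * b + W₂ * (suc b + e)
    identity : ∀ W₂ b d e → (suc W₂ + d) * (suc b + e) + W₂ * b
             ≡ ((suc W₂ + d) * b + W₂ * (suc b + e)) + suc (d + e + d * e)
    identity = solve 4 (λ W₂ b d e →
        ((con 1 :+ W₂) :+ d) :* ((con 1 :+ b) :+ e) :+ W₂ :* b
      := (((con 1 :+ W₂) :+ d) :* b :+ W₂ :* ((con 1 :+ b) :+ e)) :+ (con 1 :+ ((d :+ e) :+ d :* e))) refl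

  ∑-adjacent-change : ∀ n (i : Fin n) (f g : Fin (suc n) → ℕ) →
    (∀ k → ¬ k ≡ inject₁ i → ¬ k ≡ suc i → f k ≡ g k) →
    sum f + (g (inject₁ i) + g (suc i)) ≡ sum g + (f (inject₁ i) + f (suc i))
  ∑-adjacent-change (suc n) zero f g f≗g = begin
    (f₀ + (f₁ + rest f)) + (g₀ + g₁)  ≡⟨ shuffle f₀ f₁ g₀ g₁ (rest f) ⟩
    (g₀ + (g₁ + rest f)) + (f₀ + f₁)  ≡⟨ cong (λ z → (g₀ + (g₁ + z)) + (f₀ + f₁)) rest-f≡rest-g ⟩
    (g₀ + (g₁ + rest g)) + (f₀ + f₁)  ∎
    where
    open ≡-Reasoning
    f₀ f₁ g₀ g₁ : ℕ
    f₀ = f zero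
    f₁ = f (suc zero)
    g₀ = g zero
    g₁ = g (suc zero)
    rest : (Fin (suc (suc n)) → ℕ) → ℕ
    rest h = sum (λ k → h (suc (suc k)))
    rest-f≡rest-g : rest f ≡ rest g
    rest-f≡rest-g = sum-cong-≗ (λ k → f≗g (suc (suc k)) (λ ()) (λ ()))
    shuffle : ∀ a b c d r → (a + (b + r)) + (c + d) ≡ (c + (d + r)) + (a + b)
    shuffle = solve 5 (λ a b c d r → (a :+ (b :+ r)) :+ (c :+ d) := (c :+ (d :+ r)) :+ (a :+ b)) refl
  ∑-adjacent-change (suc n) (suc i) f g f≗g = begin
    (f zero + sum (f ∘suc)) + (g a + g b)  ≡⟨ +-assoc (f zero) _ _ ⟩
    f zero + (sum (f ∘suc) + (g a + g b))  ≡⟨ cong₂ _+_ (f≗g zero (λ ()) (λ ()))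
                                               (∑-adjacent-change n i (f ∘suc) (g ∘suc) tail-agree) ⟩
    g zero + (sum (g ∘suc) + (f a + f b))  ≡⟨ +-assoc (g zero) _ _ ⟨
    (g zero + sum (g ∘suc)) + (f a + f b)  ∎
    where
    open ≡-Reasoning
    a b : Fin (suc (suc n))
    a = inject₁ (suc i)
    b = suc (suc i)
    _∘suc : (Fin (suc (suc n)) → ℕ) → Fin (suc n) → ℕ
    (h ∘suc) k = h (suc k)
    tail-agree : ∀ k → ¬ k ≡ inject₁ i → ¬ k ≡ suc i → f (suc k) ≡ g (suc k)
    tail-agree k k≢a k≢b = f≗g (suc k) (k≢a ∘′ suc-injective) (k≢b ∘′ suc-injective)

  module _ {n : ℕ} (a b : Fin n) where

    transpose-at-a : PC.transpose a b a ≡ b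
    transpose-at-a with a ≟ a
    ... | yes _   = refl
    ... | no a≢a  = ⊥-elim (a≢a refl)

    transpose-at-b : ¬ b ≡ a → PC.transpose a b b ≡ a
    transpose-at-b b≢a with b ≟ a
    ... | yes b≡a = ⊥-elim (b≢a b≡a)
    ... | no _ with b ≟ b
    ...   | yes _  = refl
    ...   | no b≢b = ⊥-elim (b≢b refl)

    transpose-elsewhere : ∀ k → ¬ k ≡ a → ¬ k ≡ b → PC.transpose a b k ≡ k
    transpose-elsewhere k k≢a k≢b with k ≟ a
    ... | yes k≡a = ⊥-elim (k≢a k≡a)
    ... | no _ with k ≟ b
    ...   | yes k≡b = ⊥-elim (k≢b k≡b)
    ...   | no _    = refl

  inject₁≢suc : ∀ {n} (i : Fin n) → ¬ inject₁ i ≡ suc i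
  inject₁≢suc i e = <-irrefl (trans (sym (toℕ-inject₁ i)) (cong toℕ e)) (n<1+n (toℕ i))

  swapAt : ∀ {n} → Fin n → Fin (suc n) → Fin (suc n)
  swapAt i = PC.transpose (inject₁ i) (suc i)

  -- Swapping two adjacent entries that are out of (ascending) order strictly
  -- decreases the weighted sum: this is the termination measure for sorting.
  weighted-swap-< : ∀ n (i : Fin n) (h : Fin (suc n) → ℕ) → h (suc i) < h (inject₁ i) →
    ∑[ k < suc n ] (weight (suc n) k * h (swapAt i k))
      < ∑[ k < suc n ] (weight (suc n) k * h k)
  weighted-swap-< n i h h-inverted =
    +-cancelʳ-< _ _ _ (subst (_< sum g + (g a + g b)) (sym change) larger)
    where
    a b : Fin (suc n)
    a = inject₁ i
    b = suc i
    f g : Fin (suc n) → ℕ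
    f k = weight (suc n) k * h (swapAt i k)
    g k = weight (suc n) k * h k
    change : sum f + (g a + g b) ≡ sum g + (f a + f b)
    change = ∑-adjacent-change n i f g
               (λ k k≢a k≢b → cong (λ z → weight (suc n) k * h z) (transpose-elsewhere a b k k≢a k≢b))
    swapped-terms : f a + f b < g a + g b
    swapped-terms
      rewrite transpose-at-a a b | transpose-at-b a b (inject₁≢suc i ∘′ sym)
      = rearrangement (weight (suc n) a) (weight (suc n) b) (h a) (h b) (weight-decreasing n i) h-inverted
    larger : sum g + (f a + f b) < sum g + (g a + g b)
    larger = +-monoʳ-< (sum g) swapped-terms

module NormalForm where

  open MatrixEquivalence
  open BinaryValues
  open import Data.Nat hiding (_≟_)
  open import Data.Nat.Properties hiding (_≟_)
  open import Data.Fin using (Fin; zero; suc; inject₁; _≟_)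
  open import Data.Fin.Properties using (any?)
  open import Data.Fin.Permutation using (transpose)
  open import Data.Bool using (Bool; true; false; not)
  open import Data.List using (List; []; _∷_; allFin)
  open import Data.List.Membership.Propositional using (_∈_)
  open import Data.List.Membership.Propositional.Properties using (∈-allFin)
  open import Data.List.Relation.Unary.Any using (here; there)
  open import Data.Product using (∃; _×_; _,_)
  open import Data.Sum using (_⊎_; inj₁; inj₂)
  open import Data.Empty using (⊥-elim)
  open import Relation.Nullary using (yes; no)
  open import Relation.Binary.PropositionalEquality
  open import Algebra.Properties.Semiring.Sum +-*-semiring using (sum-cong-≗; sum-replicate-zero)

  FirstRowZero : ∀ {m n} → BinMatrix (suc m) n → Set
  FirstRowZero A = ∀ j → A zero j ≡ false

  RowsSorted : ∀ {m n} → BinMatrix (suc m) n → Set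
  RowsSorted {m} A = ∀ (i : Fin m) → rowValue A (inject₁ i) ≤ rowValue A (suc i)

  ColsSorted : ∀ {m n} → BinMatrix m (suc n) → Set
  ColsSorted {n = n} A = ∀ (j : Fin n) → colValue A (inject₁ j) ≤ colValue A (suc j)

  record Normalised {m n} (A : BinMatrix (suc m) (suc n)) : Set where
    field
      firstRowZero : FirstRowZero A
      rowsSorted   : RowsSorted A
      colsSorted   : ColsSorted A

  clearColumns : ∀ {m n} (js : List (Fin n)) (A : BinMatrix (suc m) n) →
    ∃ λ A′ → Equivalent A A′ × (∀ j → j ∈ js → A′ zero j ≡ false)
  clearColumns []       A = A , ~-refl , λ _ ()
  clearColumns (j ∷ js) A with clearColumns js A
  ... | A₁ , A~A₁ , cleared with A₁ zero j in A₁₀ⱼ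
  ...   | false = A₁ , A~A₁ , λ { j′ (here refl) → A₁₀ⱼ ; j′ (there j′∈js) → cleared j′ j′∈js }
  ...   | true  = complementCol j A₁ , ~-trans A~A₁ (step (colComp A₁ j) ~-refl) , cleared′
    where
    cleared′ : ∀ j′ → j′ ∈ j ∷ js → complementCol j A₁ zero j′ ≡ false
    cleared′ j′ j′∈ with j′ ≟ j | j′∈
    ... | yes refl | _           = cong not A₁₀ⱼ
    ... | no j′≢j  | here j′≡j   = ⊥-elim (j′≢j j′≡j)
    ... | no _     | there j′∈js = cleared j′ j′∈js

  clearFirstRow : ∀ {m n} (A : BinMatrix (suc m) n) → ∃ λ A′ → Equivalent A A′ × FirstRowZero A′
  clearFirstRow {n = n} A with clearColumns (allFin n) A
  ... | A′ , A~A′ , cleared = A′ , A~A′ , λ j → cleared j (∈-allFin j)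

  value-zero : ∀ n (f : Fin n → Bool) → (∀ k → f k ≡ false) → value n f ≡ 0
  value-zero n f f≡0 = trans (sum-cong-≗ {n} term≡0) (sum-replicate-zero n)
    where
    term≡0 : ∀ k → weight n k * bit (f k) ≡ 0
    term≡0 k = trans (cong (λ b → weight n k * bit b) (f≡0 k)) (*-zeroʳ (weight n k))

  rowSwap-decreases : ∀ {m n} (A : BinMatrix (suc m) n) (i : Fin m) →
    rowValue A (suc i) < rowValue A (inject₁ i) →
    rowPotential (permuteRows (transpose (inject₁ i) (suc i)) A) < rowPotential A
  rowSwap-decreases {m} A i inverted = weighted-swap-< m i (rowValue A) inverted

  colSwap-decreases : ∀ {m n} (A : BinMatrix m (suc n)) (j : Fin n) →
    colValue A (suc j) < colValue A (inject₁ j) →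
    rowPotential (permuteCols (transpose (inject₁ j) (suc j)) A) < rowPotential A
  colSwap-decreases {n = n} A j inverted =
    subst₂ _<_ (sym (rowPotential≡colPotential (permuteCols (transpose (inject₁ j) (suc j)) A)))
               (sym (rowPotential≡colPotential A))
               (weighted-swap-< n j (colValue A) inverted)

  -- A zero first row has the least value, so it is never part of an inverted
  -- pair and survives every such row swap.
  rowSwap-keeps-firstRowZero : ∀ {m n} (A : BinMatrix (suc m) n) (i : Fin m) →
    FirstRowZero A → rowValue A (suc i) < rowValue A (inject₁ i) →
    FirstRowZero (permuteRows (transpose (inject₁ i) (suc i)) A)
  rowSwap-keeps-firstRowZero {n = n} A zero A₀≡0 inverted =
    ⊥-elim (n≮0 (subst (rowValue A (suc zero) <_) (value-zero n (A zero) A₀≡0) inverted))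
  rowSwap-keeps-firstRowZero A (suc i) A₀≡0 inverted j =
    trans (cong (λ r → A r j) (transpose-elsewhere (inject₁ (suc i)) (suc (suc i)) zero (λ ()) (λ ())))
          (A₀≡0 j)

  Improvement : ∀ {m n} → BinMatrix (suc m) (suc n) → Set
  Improvement A = ∃ λ A′ → Step A A′ × rowPotential A′ < rowPotential A × FirstRowZero A′

  normalised-or-improvable : ∀ {m n} (A : BinMatrix (suc m) (suc n)) → FirstRowZero A →
    Normalised A ⊎ Improvement A
  normalised-or-improvable {m} {n} A A₀≡0
    with any? (λ (i : Fin m) → rowValue A (suc i) <? rowValue A (inject₁ i))
  ... | yes (i , inverted) = inj₂ (_ , rowPerm A (transpose (inject₁ i) (suc i)) ,
    rowSwap-decreases A i inverted , rowSwap-keeps-firstRowZero A i A₀≡0 inverted)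
  ... | no noRowInversion with any? (λ (j : Fin n) → colValue A (suc j) <? colValue A (inject₁ j))
  ...   | yes (j , inverted) = inj₂ (_ , colPerm A (transpose (inject₁ j) (suc j)) ,
    colSwap-decreases A j inverted , λ _ → A₀≡0 _)
  ...   | no noColInversion = inj₁ record
    { firstRowZero = A₀≡0
    ; rowsSorted   = λ i → ≮⇒≥ (λ inv → noRowInversion (i , inv))
    ; colsSorted   = λ j → ≮⇒≥ (λ inv → noColInversion (j , inv))
    }

  sortRowsAndCols : ∀ {m n} (fuel : ℕ) (A : BinMatrix (suc m) (suc n)) →
    rowPotential A < fuel → FirstRowZero A → ∃ λ N → Equivalent A N × Normalised N
  sortRowsAndCols zero A () _
  sortRowsAndCols (suc fuel) A bound A₀≡0 with normalised-or-improvable A A₀≡0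
  ... | inj₁ nf = A , ~-refl , nf
  ... | inj₂ (A′ , s , smaller , A′₀≡0) with sortRowsAndCols fuel A′ (≤-trans smaller (s≤s⁻¹ bound)) A′₀≡0
  ...   | N , A′~N , nf = N , step s A′~N , nf

  normalise : ∀ {m n} (A : BinMatrix (suc m) (suc n)) → ∃ λ N → Equivalent A N × Normalised N
  normalise A with clearFirstRow A
  ... | A₁ , A~A₁ , A₁₀≡0 with sortRowsAndCols (suc (rowPotential A₁)) A₁ ≤-refl A₁₀≡0
  ...   | N , A₁~N , nf = N , ~-trans A~A₁ A₁~N , nf

module ColumnBalance where

  open BooleanTests
  open ThreeColumns
  open import Data.Nat hiding (_≟_)
  open import Data.Nat.Properties
    using (≰⇒>; _≤?_; +-suc; +-comm; +-monoˡ-≤; +-cancelˡ-≤; m≤m+n; module ≤-Reasoning)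
  open import Data.Fin using (Fin; zero; suc; punchIn; inject≤)
  open import Data.Fin.Properties using (suc-injective; punchIn-injective; punchInᵢ≢i; inject≤-injective)
  open import Data.Bool using (Bool; true; false; not; T; _∧_; _∨_; if_then_else_)
  open import Data.Bool.ListAction using (all)
  open import Data.Bool.Properties using (T-∨)
  open import Data.List using (List; []; _∷_; map; _++_; length)
  open import Data.List.Membership.Propositional using (_∈_)
  open import Data.List.Membership.Propositional.Properties using (∈-++⁺ˡ; ∈-++⁺ʳ; ∈-map⁺)
  open import Data.List.Relation.Unary.Any using (here)
  open import Data.Product using (_,_)
  open import Data.Sum using (inj₁; inj₂)
  open import Data.Empty using (⊥; ⊥-elim)
  open import Function using (_∘_; Equivalence)
  open import Relation.Nullary using (¬_; yes; no)
  open import Relation.Binary.PropositionalEquality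

  occurs : Bool → Bool → List Bool → List Bool → Bool
  occurs y y′ (x ∷ xs) (z ∷ zs) = (x == y ∧ z == y′) ∨ occurs y y′ xs zs
  occurs y y′ _        _        = false

  independent : List Bool → List Bool → Bool
  independent c d = occurs true true c d ∧ occurs true false c d ∧ occurs false true c d ∧ occurs false false c d

  independent-intro : ∀ c d → (∀ y y′ → T (occurs y y′ c d)) → T (independent c d)
  independent-intro c d occ =
    ∧-intro (occ true true) (∧-intro (occ true false) (∧-intro (occ false true) (occ false false)))

  words : ℕ → List (List Bool)
  words zero    = [] ∷ []
  words (suc n) = map (true ∷_) (words n) ++ map (false ∷_) (words n)

  words-complete : ∀ w → w ∈ words (length w)
  words-complete []          = here refl
  words-complete (true ∷ w)  = ∈-++⁺ˡ (∈-map⁺ (true ∷_) (words-complete w))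
  words-complete (false ∷ w) = ∈-++⁺ʳ (map (true ∷_) (words (length w))) (∈-map⁺ (false ∷_) (words-complete w))

  -- Exhaustive search: 'noFamily n k ch' holds when ch cannot be extended by
  -- k words of length n, each independent of all words chosen before it.
  noFamily : ℕ → ℕ → List (List Bool) → Bool
  noFamily n zero    chosen = false
  noFamily n (suc k) chosen =
    all (λ c → not (all (independent c) chosen) ∨ noFamily n k (c ∷ chosen)) (words n)

  noFamily-sound : ∀ n k chosen → T (noFamily n k chosen) → (c : Fin k → List Bool) →
    (∀ i → length (c i) ≡ n) → (∀ i → T (all (independent (c i)) chosen)) →
    (∀ i j → ¬ i ≡ j → T (independent (c i) (c j))) → ⊥
  noFamily-sound n (suc k) chosen none c len indep-chosen indep =
    noFamily-sound n k (c zero ∷ chosen) none-after (c ∘ suc) (len ∘ suc)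
      (λ i → ∧-intro (indep (suc i) zero λ ()) (indep-chosen (suc i)))
      (λ i j i≢j → indep (suc i) (suc j) (i≢j ∘ suc-injective))
    where
    c₀∈words : c zero ∈ words n
    c₀∈words = subst (λ l → c zero ∈ words l) (len zero) (words-complete (c zero))
    none-after : T (noFamily n k (c zero ∷ chosen))
    none-after with Equivalence.to T-∨ (all-sound _ none c₀∈words)
    ... | inj₁ not-indep = ⊥-elim (T-not not-indep (indep-chosen zero))
    ... | inj₂ none′     = none′

  noFiveIndependent : ∀ n → n ≤ 5 → noFamily n 5 [] ≡ true
  noFiveIndependent 0 _ = refl
  noFiveIndependent 1 _ = refl
  noFiveIndependent 2 _ = refl
  noFiveIndependent 3 _ = refl
  noFiveIndependent 4 _ = refl
  noFiveIndependent 5 _ = refl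
  noFiveIndependent (suc (suc (suc (suc (suc (suc n)))))) (s≤s (s≤s (s≤s (s≤s (s≤s ())))))

  restrict : ∀ {m} → (Fin m → Bool) → Bool → (Fin m → Bool) → List Bool
  restrict {zero}  f x g = []
  restrict {suc m} f x g =
    if f zero == x then g zero ∷ restrict (f ∘ suc) x (g ∘ suc) else restrict (f ∘ suc) x (g ∘ suc)

  count : ∀ {m} → (Fin m → Bool) → Bool → ℕ
  count {zero}  f x = 0
  count {suc m} f x = (if f zero == x then 1 else 0) + count (f ∘ suc) x

  length-restrict : ∀ {m} (f : Fin m → Bool) x g → length (restrict f x g) ≡ count f x
  length-restrict {zero}  f x g = refl
  length-restrict {suc m} f x g with f zero == x
  ... | true  = cong suc (length-restrict (f ∘ suc) x (g ∘ suc))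
  ... | false = length-restrict (f ∘ suc) x (g ∘ suc)

  occurs-here : ∀ {a b y y′} xs zs → a ≡ y → b ≡ y′ → T (occurs y y′ (a ∷ xs) (b ∷ zs))
  occurs-here {a} {b} xs zs refl refl = Equivalence.from T-∨ (inj₁ (∧-intro (==-refl a) (==-refl b)))

  occurs-there : ∀ {y y′} a b xs zs → T (occurs y y′ xs zs) → T (occurs y y′ (a ∷ xs) (b ∷ zs))
  occurs-there a b xs zs occ = Equivalence.from T-∨ (inj₂ occ)

  occurs-restrict : ∀ {m} (f g h : Fin m → Bool) {x y y′} r →
    f r ≡ x → g r ≡ y → h r ≡ y′ → T (occurs y y′ (restrict f x g) (restrict f x h))
  occurs-restrict {suc m} f g h {x} {y} {y′} r fr gr hr = by-row r fr gr hr
    where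
    rest : (Fin (suc m) → Bool) → List Bool
    rest k = restrict (f ∘ suc) x (k ∘ suc)
    by-row : ∀ r → f r ≡ x → g r ≡ y → h r ≡ y′ → T (occurs y y′ (restrict f x g) (restrict f x h))
    by-row zero fr gr hr with f zero == x in eq
    ... | true  = occurs-here (rest g) (rest h) gr hr
    ... | false = ⊥-elim (subst T eq (==-reflexive fr))
    by-row (suc r) fr gr hr with f zero == x
    ... | true  = occurs-there (g zero) (h zero) (rest g) (rest h)
                    (occurs-restrict (f ∘ suc) (g ∘ suc) (h ∘ suc) r fr gr hr)
    ... | false = occurs-restrict (f ∘ suc) (g ∘ suc) (h ∘ suc) r fr gr hr

  count-complement : ∀ {m} (f : Fin m → Bool) x → count f x + count f (not x) ≡ m
  count-complement {zero}  f x = refl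
  count-complement {suc m} f x with f zero | x
  ... | true  | true  = cong suc (count-complement (f ∘ suc) true)
  ... | false | false = cong suc (count-complement (f ∘ suc) false)
  ... | true  | false = trans (+-suc (count (f ∘ suc) false) _) (cong suc (count-complement (f ∘ suc) false))
  ... | false | true  = trans (+-suc (count (f ∘ suc) true) _) (cong suc (count-complement (f ∘ suc) true))

  -- In a 3-covering array with at least five further columns, each value
  -- occurs at least six times in every column: the rows where column a has
  -- value x restrict the other columns to pairwise independent words, and
  -- five such words need length at least six.
  column-balanced : ∀ {m n} {A : BinMatrix m (suc n)} → IsCoveringArray 3 m (suc n) A → 5 ≤ n →
    ∀ a x → 6 ≤ count (λ r → A r a) x
  column-balanced {m} {n} {A} ca 5≤n a x with 6 ≤? count (λ r → A r a) x
  ... | yes six≤ = six≤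
  ... | no ¬six≤ = ⊥-elim (noFamily-sound (count column x) 5 []
          (≡true⇒T (noFiveIndependent _ (s≤s⁻¹ (≰⇒> ¬six≤))))
          word (λ k → length-restrict column x _) (λ _ → _) independence)
    where
    column : Fin m → Bool
    column r = A r a
    other : Fin 5 → Fin (suc n)
    other k = punchIn a (inject≤ k 5≤n)
    word : Fin 5 → List Bool
    word k = restrict column x (λ r → A r (other k))
    independence : ∀ k l → ¬ k ≡ l → T (independent (word k) (word l))
    independence k l k≢l = independent-intro (word k) (word l) λ y y′ →
      let r , ra , rk , rl = covers3 {A = A} ca (punchInᵢ≢i a _ ∘ sym) (punchInᵢ≢i a _ ∘ sym)
                                     (k≢l ∘ inject≤-injective 5≤n 5≤n k l ∘ punchIn-injective a _ _) x y y′
      in occurs-restrict column (λ r → A r (other k)) (λ r → A r (other l)) r ra rk rl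

  column-weight≤6 : ∀ {A : BinMatrix 12 11} → IsCoveringArray 3 12 11 A →
    ∀ a x → count (λ r → A r a) x ≤ 6
  column-weight≤6 {A} ca a x = +-cancelˡ-≤ 6 _ 6 (begin
    6 + count column x                   ≤⟨ +-monoˡ-≤ _ (column-balanced {A = A} ca (m≤m+n 5 5) a (not x)) ⟩
    count column (not x) + count column x ≡⟨ +-comm (count column (not x)) _ ⟩
    count column x + count column (not x) ≡⟨ count-complement column x ⟩
    12                                    ∎)
    where
    open ≤-Reasoning
    column : Fin 12 → Bool
    column r = A r a

module Solutions where

  open import Data.Bool using (Bool; true; false)
  open import Data.Vec using (Vec; []; _∷_; lookup)

  -- Bits written as O and I, so that the matrices below can be read row by row.
  O I : Bool
  O = false
  I = true

  rows₁ : Vec (Vec Bool 11) 12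
  rows₁ =
    (O ∷ O ∷ O ∷ O ∷ O ∷ O ∷ O ∷ O ∷ O ∷ O ∷ O ∷ []) ∷
    (O ∷ O ∷ O ∷ O ∷ O ∷ I ∷ I ∷ I ∷ I ∷ I ∷ I ∷ []) ∷
    (O ∷ O ∷ I ∷ I ∷ I ∷ O ∷ O ∷ O ∷ I ∷ I ∷ I ∷ []) ∷
    (O ∷ I ∷ O ∷ I ∷ I ∷ O ∷ I ∷ I ∷ O ∷ O ∷ I ∷ []) ∷
    (O ∷ I ∷ I ∷ O ∷ I ∷ I ∷ O ∷ I ∷ O ∷ I ∷ O ∷ []) ∷
    (O ∷ I ∷ I ∷ I ∷ O ∷ I ∷ I ∷ O ∷ I ∷ O ∷ O ∷ []) ∷
    (I ∷ O ∷ O ∷ I ∷ I ∷ I ∷ I ∷ O ∷ O ∷ I ∷ O ∷ []) ∷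
    (I ∷ O ∷ I ∷ O ∷ I ∷ O ∷ I ∷ I ∷ I ∷ O ∷ O ∷ []) ∷
    (I ∷ O ∷ I ∷ I ∷ O ∷ I ∷ O ∷ I ∷ O ∷ O ∷ I ∷ []) ∷
    (I ∷ I ∷ O ∷ O ∷ I ∷ I ∷ O ∷ O ∷ I ∷ O ∷ I ∷ []) ∷
    (I ∷ I ∷ O ∷ I ∷ O ∷ O ∷ O ∷ I ∷ I ∷ I ∷ O ∷ []) ∷
    (I ∷ I ∷ I ∷ O ∷ O ∷ O ∷ I ∷ O ∷ O ∷ I ∷ I ∷ []) ∷
    []

  rows₂ : Vec (Vec Bool 11) 12
  rows₂ =
    (O ∷ O ∷ O ∷ O ∷ O ∷ O ∷ O ∷ O ∷ O ∷ O ∷ O ∷ []) ∷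
    (O ∷ O ∷ O ∷ O ∷ O ∷ I ∷ I ∷ I ∷ I ∷ I ∷ I ∷ []) ∷
    (O ∷ O ∷ I ∷ I ∷ I ∷ O ∷ O ∷ O ∷ I ∷ I ∷ I ∷ []) ∷
    (O ∷ I ∷ O ∷ I ∷ I ∷ O ∷ I ∷ I ∷ O ∷ O ∷ I ∷ []) ∷
    (O ∷ I ∷ I ∷ O ∷ I ∷ I ∷ O ∷ I ∷ O ∷ I ∷ O ∷ []) ∷
    (O ∷ I ∷ I ∷ I ∷ O ∷ I ∷ I ∷ O ∷ I ∷ O ∷ O ∷ []) ∷
    (I ∷ O ∷ O ∷ I ∷ I ∷ I ∷ O ∷ I ∷ I ∷ O ∷ O ∷ []) ∷
    (I ∷ O ∷ I ∷ O ∷ I ∷ I ∷ I ∷ O ∷ O ∷ O ∷ I ∷ []) ∷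
    (I ∷ O ∷ I ∷ I ∷ O ∷ O ∷ I ∷ I ∷ O ∷ I ∷ O ∷ []) ∷
    (I ∷ I ∷ O ∷ O ∷ I ∷ O ∷ I ∷ O ∷ I ∷ I ∷ O ∷ []) ∷
    (I ∷ I ∷ O ∷ I ∷ O ∷ I ∷ O ∷ O ∷ O ∷ I ∷ I ∷ []) ∷
    (I ∷ I ∷ I ∷ O ∷ O ∷ O ∷ O ∷ I ∷ I ∷ O ∷ I ∷ []) ∷
    []

  S₁ S₂ : BinMatrix 12 11
  S₁ r c = lookup (lookup rows₁ r) c
  S₂ r c = lookup (lookup rows₂ r) c

module Search where

  open BooleanTests
  open ColumnBalance using (independent)
  open Solutions
  open MatrixEquivalence using (_≋ᵇ_)
  open import Data.Nat using (ℕ; zero; suc; _+_; _≤ᵇ_; _≡ᵇ_)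
  open import Data.Fin using (Fin; zero; suc; toℕ; inject₁)
  open import Data.Bool using (Bool; true; false; not; _∧_; _∨_; if_then_else_)
  open import Data.Bool.ListAction using (all)
  open import Data.List using (List; []; _∷_; map)
  open import Data.Maybe using (Maybe; just; nothing; fromMaybe)
  open import Data.Product using (_×_; _,_; proj₁; proj₂)
  open import Data.Vec using (Vec; []; _∷_; lookup; updateAt; replicate; toList)
  open import Function using (_∘_)

  -- A partially filled 12 × 11 matrix, stored as its list of columns.  Cells
  -- are filled column by column, top to bottom.
  Board : Set
  Board = Vec (Vec Bool 12) 11

  entry : Board → Fin 12 → Fin 11 → Bool
  entry K r c = lookup (lookup K c) r

  write : Board → Fin 12 → Fin 11 → Bool → Board
  write K r c v = updateAt K c (λ column → updateAt column r (λ _ → v))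

  emptyBoard : Board
  emptyBoard = replicate 11 (replicate 12 false)

  successor : ∀ {n} → Fin n → Maybe (Fin n)
  successor {suc zero}    zero    = nothing
  successor {suc (suc n)} zero    = just (suc zero)
  successor {suc (suc n)} (suc i) = Data.Maybe.map suc (successor i)

  -- The cell filled after (i , j); the last cell is followed by (0 , 0).
  nextCell : Fin 12 → Fin 11 → Fin 12 × Fin 11
  nextCell i j with successor i
  ... | just i′ = i′ , j
  ... | nothing = zero , fromMaybe zero (successor j)

  below : ∀ {n} → Fin n → List (Fin n)
  below zero    = []
  below (suc j) = zero ∷ map suc (below j)

  countPrefix : ∀ {n} → Vec Bool n → ℕ → Bool → ℕ
  countPrefix []       k       v = 0
  countPrefix (x ∷ xs) zero    v = 0
  countPrefix (x ∷ xs) (suc k) v = (if x == v then 1 else 0) + countPrefix xs k v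

  lexStep : Bool → Bool → Bool → Bool
  lexStep false true  rest = true
  lexStep true  false rest = false
  lexStep _     _     rest = rest

  lexPrefix≤ : ∀ {n} → (Fin n → Bool) → (Fin n → Bool) → ℕ → Bool
  lexPrefix≤ {zero}  f g k       = true
  lexPrefix≤ {suc n} f g zero    = true
  lexPrefix≤ {suc n} f g (suc k) = lexStep (f zero) (g zero) (lexPrefix≤ (f ∘ suc) (g ∘ suc) k)

  -- Some row can still carry the pattern (x , y , z) in the columns as, bs,
  -- cs, of which cs is only known in its first k entries.
  coverable : ∀ {n} → Bool → Bool → Bool → Vec Bool n → Vec Bool n → Vec Bool n → ℕ → Bool
  coverable x y z []       []       []       k       = false
  coverable x y z (a ∷ as) (b ∷ bs) (c ∷ cs) zero    = (a == x ∧ b == y) ∨ coverable x y z as bs cs zero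
  coverable x y z (a ∷ as) (b ∷ bs) (c ∷ cs) (suc k) = (a == x ∧ b == y ∧ c == z) ∨ coverable x y z as bs cs k

  -- They only look
  -- at the filled cells and hold for every normalised 3-covering array whose
  -- columns contain each value at most six times.

  firstRowOK : Fin 12 → Bool → Bool
  firstRowOK zero    v = not v
  firstRowOK (suc _) v = true

  weightOK : Fin 12 → Fin 11 → Board → Bool → Bool
  weightOK i j K v = countPrefix (lookup K j) (suc (toℕ i)) v ≤ᵇ 6

  rowOrderOK : Fin 12 → Fin 11 → Board → Bool
  rowOrderOK zero    j K = true
  rowOrderOK (suc i) j K = lexPrefix≤ (entry K (inject₁ i)) (entry K (suc i)) (suc (toℕ j))

  colOrderOK : Fin 12 → Fin 11 → Board → Bool
  colOrderOK i zero    K = true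
  colOrderOK i (suc j) K = lexPrefix≤ (lookup (lookup K (inject₁ j))) (lookup (lookup K (suc j))) (suc (toℕ i))

  triplesOK : Fin 12 → Fin 11 → Board → Bool → Bool
  triplesOK i j K v = all (λ b → all (λ a →
    coverable (entry K i a) (entry K i b) (not v) (lookup K a) (lookup K b) (lookup K j) (suc (toℕ i)))
    (below b)) (below j)

  pairsOK : Fin 12 → Fin 11 → Board → Bool
  pairsOK i j K = not (toℕ i ≡ᵇ 11) ∨ all (λ a → independent (toList (lookup K a)) (toList (lookup K j))) (below j)

  admissible : Fin 12 → Fin 11 → Board → Bool → Bool
  admissible i j K v = firstRowOK i v ∧ weightOK i j K v ∧ rowOrderOK i j K ∧ colOrderOK i j K
                     ∧ triplesOK i j K v ∧ pairsOK i j K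

  isSolution : Board → Bool
  isSolution K = entry K ≋ᵇ S₁ ∨ entry K ≋ᵇ S₂

  search : ℕ → Fin 12 → Fin 11 → Board → Bool
  extend : ℕ → Fin 12 → Fin 11 → Board → Bool → Bool
  search zero    i j K = isSolution K
  search (suc f) i j K = extend f i j K false ∧ extend f i j K true
  extend f i j K v = not (admissible i j (write K i j v) v)
                   ∨ search f (proj₁ (nextCell i j)) (proj₂ (nextCell i j)) (write K i j v)

module SearchLemmas where

  open BooleanTests
  open ColumnBalance using (occurs; occurs-here; occurs-there; count)
  open BinaryValues using (value; leading-bit; tail-≤)
  open Search
  open import Data.Nat hiding (_≟_)
  open import Data.Nat.Properties hiding (_≟_)
  open import Data.Fin using (Fin; zero; suc; toℕ; _≟_)
  open import Data.Fin.Properties using (toℕ-injective; toℕ<n)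
  open import Data.Bool using (Bool; true; false; T; if_then_else_)
  open import Data.Bool.Properties using (T-∨)
  open import Data.List.Membership.Propositional using (_∈_)
  open import Data.List.Membership.Propositional.Properties using (∈-map⁻)
  open import Data.List.Relation.Unary.Any using (here; there)
  open import Data.Maybe using (just; nothing)
  open import Data.Product using (_×_; _,_; proj₁; proj₂)
  open import Data.Sum using (inj₁; inj₂)
  open import Data.Vec using (Vec; []; _∷_; lookup; toList)
  open import Data.Vec.Properties using (lookup∘updateAt; lookup∘updateAt′)
  open import Data.Empty using (⊥-elim)
  open import Function using (_∘_; Equivalence)
  open import Relation.Nullary using (¬_; yes; no)
  open import Relation.Binary.PropositionalEquality
  open import Relation.Binary.Definitions using (tri<; tri≈; tri>)
  open import Data.Nat.Solver using (module +-*-Solver)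
  open +-*-Solver using (solve; _:+_; _:*_; _:=_; con)

  entry-write-same : ∀ K i j v → entry (write K i j v) i j ≡ v
  entry-write-same K i j v =
    trans (cong (λ column → lookup column i) (lookup∘updateAt j K)) (lookup∘updateAt i (lookup K j))

  entry-write-other : ∀ K i j v r c → ¬ (r ≡ i × c ≡ j) → entry (write K i j v) r c ≡ entry K r c
  entry-write-other K i j v r c ≢cell with c ≟ j
  ... | no c≢j = cong (λ column → lookup column r) (lookup∘updateAt′ c j c≢j K)
  ... | yes refl with r ≟ i
  ...   | yes refl = ⊥-elim (≢cell (refl , refl))
  ...   | no r≢i = trans (cong (λ column → lookup column r) (lookup∘updateAt c K))
                         (lookup∘updateAt′ r i r≢i (lookup K c))

  position : Fin 12 → Fin 11 → ℕ
  position r c = toℕ c * 12 + toℕ r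

  position-< : ∀ c c′ r r′ → c < c′ → r < 12 → c * 12 + r < c′ * 12 + r′
  position-< c c′ r r′ c<c′ r<12 = begin-strict
    c * 12 + r   <⟨ +-monoʳ-< (c * 12) r<12 ⟩
    c * 12 + 12  ≡⟨ +-comm (c * 12) 12 ⟩
    suc c * 12   ≤⟨ *-monoˡ-≤ 12 c<c′ ⟩
    c′ * 12      ≤⟨ m≤m+n (c′ * 12) r′ ⟩
    c′ * 12 + r′ ∎
    where open ≤-Reasoning

  position-injective : ∀ r c i j → position r c ≡ position i j → r ≡ i × c ≡ j
  position-injective r c i j eq with <-cmp (toℕ c) (toℕ j)
  ... | tri< c<j _ _ = ⊥-elim (<-irrefl eq (position-< (toℕ c) (toℕ j) (toℕ r) (toℕ i) c<j (toℕ<n r)))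
  ... | tri> _ _ j<c = ⊥-elim (<-irrefl (sym eq) (position-< (toℕ j) (toℕ c) (toℕ i) (toℕ r) j<c (toℕ<n i)))
  ... | tri≈ _ c≡j _ = toℕ-injective (+-cancelˡ-≡ (toℕ c * 12) (toℕ r) (toℕ i)
                          (trans eq (cong (λ z → z * 12 + toℕ i) (sym c≡j)))) , toℕ-injective c≡j

  position<132 : ∀ r c → position r c < 132
  position<132 r c = position-< (toℕ c) 11 (toℕ r) 0 (toℕ<n c) (toℕ<n r)

  successor-just : ∀ {n} (i : Fin n) {i′} → successor i ≡ just i′ → toℕ i′ ≡ suc (toℕ i)
  successor-just {suc (suc n)} zero    refl = refl
  successor-just {suc (suc n)} (suc i) e with successor i in eq
  ... | just _ with refl ← e = cong suc (successor-just i eq)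

  successor-nothing : ∀ {n} (i : Fin (suc n)) → successor i ≡ nothing → toℕ i ≡ n
  successor-nothing {zero}  zero    refl = refl
  successor-nothing {suc n} (suc i) e with successor i in eq
  ... | nothing = cong suc (successor-nothing i eq)

  nextCell-position : ∀ i j → position i j < 131 →
    position (proj₁ (nextCell i j)) (proj₂ (nextCell i j)) ≡ suc (position i j)
  nextCell-position i j p<131 with successor i in eqi
  ... | just i′ = trans (cong (toℕ j * 12 +_) (successor-just i eqi)) (+-suc (toℕ j * 12) (toℕ i))
  ... | nothing with successor j in eqj
  ...   | just j′ = begin
    toℕ j′ * 12 + 0           ≡⟨ cong (λ c → c * 12 + 0) (successor-just j eqj) ⟩
    suc (toℕ j) * 12 + 0      ≡⟨ next-column (toℕ j) ⟩
    suc (toℕ j * 12 + 11)     ≡⟨ cong (λ r → suc (toℕ j * 12 + r)) (sym (successor-nothing i eqi)) ⟩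
    suc (toℕ j * 12 + toℕ i)  ∎
    where
    open ≡-Reasoning
    next-column : ∀ c → suc c * 12 + 0 ≡ suc (c * 12 + 11)
    next-column = solve 1 (λ c → (con 1 :+ c) :* con 12 :+ con 0 := con 1 :+ (c :* con 12 :+ con 11)) refl
  ...   | nothing = ⊥-elim (<-irrefl last-cell p<131)
    where
    last-cell : position i j ≡ 131
    last-cell = cong₂ (λ c r → c * 12 + r) (successor-nothing j eqj) (successor-nothing i eqi)

  below-sound : ∀ {n} (j : Fin n) {a} → a ∈ below j → toℕ a < toℕ j
  below-sound (suc j) (here refl) = s≤s z≤n
  below-sound (suc j) (there a∈) with ∈-map⁻ suc a∈
  ... | b , b∈ , refl = s≤s (below-sound j b∈)

  countPrefix≤count : ∀ {n} (xs : Vec Bool n) k (f : Fin n → Bool) v →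
    (∀ r → toℕ r < k → lookup xs r ≡ f r) → countPrefix xs k v ≤ count f v
  countPrefix≤count []       k       f v agree = z≤n
  countPrefix≤count (x ∷ xs) zero    f v agree = z≤n
  countPrefix≤count (x ∷ xs) (suc k) f v agree rewrite agree zero z<s =
    +-monoʳ-≤ (if f zero == v then 1 else 0)
              (countPrefix≤count xs k (f ∘ suc) v (λ r r<k → agree (suc r) (s≤s r<k)))

  lexStep-complete : ∀ a b {rest} → (a ≡ b → T rest) → ¬ (a ≡ true × b ≡ false) → T (lexStep a b rest)
  lexStep-complete false false same _ = same refl
  lexStep-complete true  true  same _ = same refl
  lexStep-complete false true  _    _ = _
  lexStep-complete true  false _ not-descending = not-descending (refl , refl)

  lexPrefix≤-complete : ∀ {n} (f g : Fin n → Bool) k → value n f ≤ value n g → T (lexPrefix≤ f g k)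
  lexPrefix≤-complete {zero}  f g k       f≤g = _
  lexPrefix≤-complete {suc n} f g zero    f≤g = _
  lexPrefix≤-complete {suc n} f g (suc k) f≤g = lexStep-complete (f zero) (g zero)
    (λ f₀≡g₀ → lexPrefix≤-complete (f ∘ suc) (g ∘ suc) k (tail-≤ n f g f₀≡g₀ f≤g))
    (λ (f₀ , g₀) → <⇒≱ (leading-bit n f g f₀ g₀) f≤g)

  lexPrefix≤-cong : ∀ {n} {f f′ g g′ : Fin n → Bool} k →
    (∀ c → toℕ c < k → f c ≡ f′ c) → (∀ c → toℕ c < k → g c ≡ g′ c) →
    lexPrefix≤ f g k ≡ lexPrefix≤ f′ g′ k
  lexPrefix≤-cong {zero}  k       _  _  = refl
  lexPrefix≤-cong {suc n} zero    _  _  = refl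
  lexPrefix≤-cong {suc n} {f} {f′} {g} {g′} (suc k) f≗f′ g≗g′ = begin
    lexStep (f zero)  (g zero)  (lexPrefix≤ (f ∘ suc) (g ∘ suc) k)
      ≡⟨ cong₂ (λ a b → lexStep a b _) (f≗f′ zero z<s) (g≗g′ zero z<s) ⟩
    lexStep (f′ zero) (g′ zero) (lexPrefix≤ (f ∘ suc) (g ∘ suc) k)
      ≡⟨ cong (lexStep (f′ zero) (g′ zero))
              (lexPrefix≤-cong k (λ c c<k → f≗f′ (suc c) (s≤s c<k)) (λ c c<k → g≗g′ (suc c) (s≤s c<k))) ⟩
    lexStep (f′ zero) (g′ zero) (lexPrefix≤ (f′ ∘ suc) (g′ ∘ suc) k)
      ∎
    where open ≡-Reasoning

  coverable-intro : ∀ {n} (as bs cs : Vec Bool n) k (F G H : Fin n → Bool) →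
    (∀ r → lookup as r ≡ F r) → (∀ r → lookup bs r ≡ G r) → (∀ r → toℕ r < k → lookup cs r ≡ H r) →
    ∀ {x y z} r → F r ≡ x → G r ≡ y → H r ≡ z → T (coverable x y z as bs cs k)
  coverable-intro (a ∷ as) (b ∷ bs) (c ∷ cs) zero F G H ≗F ≗G ≗H zero Fr Gr Hr =
    Equivalence.from T-∨ (inj₁ (∧-intro (==-reflexive (trans (≗F zero) Fr)) (==-reflexive (trans (≗G zero) Gr))))
  coverable-intro (a ∷ as) (b ∷ bs) (c ∷ cs) (suc k) F G H ≗F ≗G ≗H zero Fr Gr Hr =
    Equivalence.from T-∨ (inj₁ (∧-intro (==-reflexive (trans (≗F zero) Fr))
      (∧-intro (==-reflexive (trans (≗G zero) Gr)) (==-reflexive (trans (≗H zero z<s) Hr)))))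
  coverable-intro (a ∷ as) (b ∷ bs) (c ∷ cs) zero F G H ≗F ≗G ≗H (suc r) Fr Gr Hr =
    Equivalence.from T-∨ (inj₂ (coverable-intro as bs cs zero (F ∘ suc) (G ∘ suc) (H ∘ suc)
      (≗F ∘ suc) (≗G ∘ suc) (λ _ ()) r Fr Gr Hr))
  coverable-intro (a ∷ as) (b ∷ bs) (c ∷ cs) (suc k) F G H ≗F ≗G ≗H (suc r) Fr Gr Hr =
    Equivalence.from T-∨ (inj₂ (coverable-intro as bs cs k (F ∘ suc) (G ∘ suc) (H ∘ suc)
      (≗F ∘ suc) (≗G ∘ suc) (λ r′ r′<k → ≗H (suc r′) (s≤s r′<k)) r Fr Gr Hr))

  occurs-lookup : ∀ {n} (xs zs : Vec Bool n) r {y y′} → lookup xs r ≡ y → lookup zs r ≡ y′ →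
    T (occurs y y′ (toList xs) (toList zs))
  occurs-lookup (x ∷ xs) (z ∷ zs) zero    xr zr = occurs-here (toList xs) (toList zs) xr zr
  occurs-lookup (x ∷ xs) (z ∷ zs) (suc r) xr zr =
    occurs-there x z (toList xs) (toList zs) (occurs-lookup xs zs r xr zr)

  extend-chosen : ∀ f i j K v → T (search (suc f) i j K) → T (extend f i j K v)
  extend-chosen f i j K false found = proj₁ (∧-elim {extend f i j K false} found)
  extend-chosen f i j K true  found = proj₂ (∧-elim {extend f i j K false} found)

module SearchSoundness where

  open BooleanTests
  open MatrixEquivalence using (_≋_; ≋ᵇ-sound)
  open NormalForm using (Normalised)
  open ThreeColumns using (covers3; covers2)
  open ColumnBalance using (count; occurs; independent-intro)
  open Solutions
  open Search
  open SearchLemmas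
  open import Data.Nat hiding (_≟_)
  open import Data.Nat.Properties hiding (_≟_)
  open import Data.Fin using (Fin; zero; suc; toℕ; inject₁)
  open import Data.Fin.Properties using (toℕ-injective; toℕ<n; toℕ-inject₁) renaming (<⇒≢ to <⇒≢ᶠ)
  open import Data.Bool using (Bool; true; false; not; T)
  open import Data.Bool.Properties using (T-∨)
  open import Data.Product using (_,_; proj₁; proj₂)
  open import Data.Sum using (_⊎_; inj₁; inj₂)
  open import Data.Vec using (lookup; toList)
  open import Data.Empty using (⊥-elim)
  open import Function using (Equivalence)
  open import Relation.Binary.PropositionalEquality

  module _ (N : BinMatrix 12 11) (ca : IsCoveringArray 3 12 11 N) (nf : Normalised N)
           (balanced : ∀ a v → count (λ r → N r a) v ≤ 6) where

    open Normalised nf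

    record Agrees (i : Fin 12) (j : Fin 11) (K : Board) : Set where
      field
        left  : ∀ r c → toℕ c < toℕ j → entry K r c ≡ N r c
        above : ∀ r → toℕ r ≤ toℕ i → entry K r j ≡ N r j

      upToCell : ∀ r c → toℕ c ≤ toℕ j → toℕ r ≤ toℕ i → entry K r c ≡ N r c
      upToCell r c c≤j r≤i with m≤n⇒m<n∨m≡n c≤j
      ... | inj₁ c<j = left r c c<j
      ... | inj₂ c≡j rewrite toℕ-injective c≡j = above r r≤i

    open Agrees

    firstRow-holds : ∀ i j → T (firstRowOK i (N i j))
    firstRow-holds zero    j rewrite firstRowZero j = _
    firstRow-holds (suc i) j = _

    weight-holds : ∀ i j K → Agrees i j K → T (weightOK i j K (N i j))
    weight-holds i j K agrees = ≤⇒≤ᵇ (≤-trans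
      (countPrefix≤count (lookup K j) (suc (toℕ i)) (λ r → N r j) (N i j) (λ r r≤i → above agrees r (s≤s⁻¹ r≤i)))
      (balanced j (N i j)))

    rowOrder-holds : ∀ i j K → Agrees i j K → T (rowOrderOK i j K)
    rowOrder-holds zero    j K agrees = _
    rowOrder-holds (suc i) j K agrees = subst T
      (sym (lexPrefix≤-cong (suc (toℕ j))
        (λ c c≤j → upToCell agrees (inject₁ i) c (s≤s⁻¹ c≤j)
                            (≤-trans (≤-reflexive (toℕ-inject₁ i)) (n≤1+n (toℕ i))))
        (λ c c≤j → upToCell agrees (suc i) c (s≤s⁻¹ c≤j) ≤-refl)))
      (lexPrefix≤-complete (N (inject₁ i)) (N (suc i)) (suc (toℕ j)) (rowsSorted i))

    colOrder-holds : ∀ i j K → Agrees i j K → T (colOrderOK i j K)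
    colOrder-holds i zero    K agrees = _
    colOrder-holds i (suc j) K agrees = subst T
      (sym (lexPrefix≤-cong (suc (toℕ i))
        (λ r _ → left agrees r (inject₁ j) (s≤s (≤-reflexive (toℕ-inject₁ j))))
        (λ r r≤i → above agrees r (s≤s⁻¹ r≤i))))
      (lexPrefix≤-complete (λ r → N r (inject₁ j)) (λ r → N r (suc j)) (suc (toℕ i)) (colsSorted j))

    triples-holds : ∀ i j K → Agrees i j K → T (triplesOK i j K (N i j))
    triples-holds i j K agrees =
      all-intro _ λ {b} b<j → all-intro _ λ {a} a<b → coverable-at a b (below-sound b a<b) (below-sound j b<j)
      where
      coverable-at : ∀ a b → toℕ a < toℕ b → toℕ b < toℕ j →
        T (coverable (entry K i a) (entry K i b) (not (N i j)) (lookup K a) (lookup K b) (lookup K j) (suc (toℕ i)))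
      coverable-at a b a<b b<j
        with covers3 {A = N} ca (<⇒≢ᶠ a<b) (<⇒≢ᶠ (<-trans a<b b<j)) (<⇒≢ᶠ b<j)
                     (entry K i a) (entry K i b) (not (N i j))
      ... | r , ra , rb , rj = coverable-intro (lookup K a) (lookup K b) (lookup K j) (suc (toℕ i))
        (λ r → N r a) (λ r → N r b) (λ r → N r j)
        (λ r → left agrees r a (<-trans a<b b<j)) (λ r → left agrees r b b<j) (λ r r≤i → above agrees r (s≤s⁻¹ r≤i))
        r ra rb rj

    pairs-holds : ∀ i j K → Agrees i j K → T (pairsOK i j K)
    pairs-holds i j K agrees with toℕ i ≡ᵇ 11 in lastRow
    ... | false = _
    ... | true  = all-intro _ λ {a} a<j →
      independent-intro (toList (lookup K a)) (toList (lookup K j)) (occurs-at a (below-sound j a<j))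
      where
      occurs-at : ∀ a → toℕ a < toℕ j → ∀ y y′ → T (occurs y y′ (toList (lookup K a)) (toList (lookup K j)))
      occurs-at a a<j y y′ with covers2 {A = N} ca (<⇒≢ᶠ a<j) y y′
      ... | r , ra , rj = occurs-lookup (lookup K a) (lookup K j) r (trans (left agrees r a a<j) ra)
        (trans (above agrees r r≤i) rj)
        where
        r≤i : toℕ r ≤ toℕ i
        r≤i = subst (toℕ r ≤_) (sym (≡ᵇ⇒≡ (toℕ i) 11 (≡true⇒T lastRow))) (s≤s⁻¹ (toℕ<n r))

    admissible-holds : ∀ i j K → Agrees i j K → T (admissible i j K (N i j))
    admissible-holds i j K agrees =
      ∧-intro (firstRow-holds i j) (∧-intro (weight-holds i j K agrees) (∧-intro (rowOrder-holds i j K agrees)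
        (∧-intro (colOrder-holds i j K agrees) (∧-intro (triples-holds i j K agrees) (pairs-holds i j K agrees)))))

    AgreeBefore : Board → ℕ → Set
    AgreeBefore K p = ∀ r c → position r c < p → entry K r c ≡ N r c

    agree-write : ∀ i j K p → position i j ≡ p → AgreeBefore K p → AgreeBefore (write K i j (N i j)) (suc p)
    agree-write i j K p at agree r c r,c≤p with m≤n⇒m<n∨m≡n (s≤s⁻¹ r,c≤p)
    ... | inj₁ r,c<p = trans (entry-write-other K i j (N i j) r c (λ (r≡i , c≡j) →
                         <-irrefl (trans (cong₂ position r≡i c≡j) at) r,c<p)) (agree r c r,c<p)
    ... | inj₂ r,c≡p with position-injective r c i j (trans r,c≡p (sym at))
    ...   | refl , refl = entry-write-same K i j (N i j)

    agree⇒Agrees : ∀ i j K p → position i j ≡ p → AgreeBefore K (suc p) → Agrees i j K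
    agree⇒Agrees i j K p at agree = record
      { left  = λ r c c<j → agree r c (≤-trans (position-< (toℕ c) (toℕ j) (toℕ r) (toℕ i) c<j (toℕ<n r))
                                                (≤-trans (≤-reflexive at) (n≤1+n p)))
      ; above = λ r r≤i → agree r j (s≤s (≤-trans (+-monoʳ-≤ (toℕ j * 12) r≤i) (≤-reflexive at)))
      }

    search-sound : ∀ f i j K p → search f i j K ≡ true → f + p ≡ 132 → (0 < f → position i j ≡ p) →
      AgreeBefore K p → N ≋ S₁ ⊎ N ≋ S₂
    search-sound zero i j K p found refl _ agree with Equivalence.to T-∨ (≡true⇒T found)
    ... | inj₁ is-S₁ = inj₁ λ r c → trans (sym (agree r c (position<132 r c))) (≋ᵇ-sound (entry K) S₁ is-S₁ r c)
    ... | inj₂ is-S₂ = inj₂ λ r c → trans (sym (agree r c (position<132 r c))) (≋ᵇ-sound (entry K) S₂ is-S₂ r c)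
    search-sound (suc f) i j K p found f+p at agree =
      search-sound f (proj₁ (nextCell i j)) (proj₂ (nextCell i j)) K′ (suc p) (T⇒≡true continue)
        (trans (+-suc f p) f+p) next-at agree′
      where
      K′ : Board
      K′ = write K i j (N i j)
      agree′ : AgreeBefore K′ (suc p)
      agree′ = agree-write i j K p (at z<s) agree
      continue : T (search f (proj₁ (nextCell i j)) (proj₂ (nextCell i j)) K′)
      continue with Equivalence.to T-∨ (extend-chosen f i j K (N i j) (≡true⇒T found))
      ... | inj₁ rejected =
        ⊥-elim (T-not rejected (admissible-holds i j K′ (agree⇒Agrees i j K′ p (at z<s) agree′)))
      ... | inj₂ found′   = found′
      next-at : 0 < f → position (proj₁ (nextCell i j)) (proj₂ (nextCell i j)) ≡ suc p
      next-at 0<f = trans (nextCell-position i j (subst (_< 131) (sym (at z<s)) (not-last f 0<f f+p)))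
                          (cong suc (at z<s))
        where
        not-last : ∀ f → 0 < f → suc f + p ≡ 132 → p < 131
        not-last (suc f) _ f+p = s≤s (subst (p ≤_) (suc-injective (suc-injective f+p)) (m≤n+m p f))

open BooleanTests
open MatrixEquivalence
open NormalForm using (Normalised; normalise)
open ThreeColumns using (covers3-intro)
open ColumnBalance using (column-weight≤6)
open Solutions
open Search
open SearchSoundness using (search-sound)
open import Data.Nat using (ℕ)
open import Data.Fin using (Fin; zero; #_; _≟_)
open import Data.Fin.Permutation using (transpose)
open import Data.Bool using (Bool; true; T; _∧_; _∨_)
open import Data.Bool.Properties using (T-∨)
open import Data.List using (List; []; _∷_)
open import Data.Product using (∃; _×_; _,_)
open import Data.Sum using (_⊎_; inj₁; inj₂; [_,_]′)
open import Data.Empty using (⊥-elim)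
open import Function using (Equivalence)
open import Relation.Nullary using (¬_)
open import Relation.Nullary.Decidable using (isYes; toWitness)
open import Relation.Binary.PropositionalEquality

data Move (m n : ℕ) : Set where
  flipCol  : Fin n → Move m n
  swapRows : Fin m → Fin m → Move m n
  swapCols : Fin n → Fin n → Move m n

apply : ∀ {m n} → Move m n → BinMatrix m n → BinMatrix m n
apply (flipCol j)    = complementCol j
apply (swapRows a b) = permuteRows (transpose a b)
apply (swapCols a b) = permuteCols (transpose a b)

applyAll : ∀ {m n} → List (Move m n) → BinMatrix m n → BinMatrix m n
applyAll []       A = A
applyAll (μ ∷ μs) A = applyAll μs (apply μ A)

applyAll-equivalent : ∀ {m n} (μs : List (Move m n)) A → Equivalent A (applyAll μs A)
applyAll-equivalent []                  A = ~-refl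
applyAll-equivalent (flipCol j    ∷ μs) A = step (colComp A j) (applyAll-equivalent μs _)
applyAll-equivalent (swapRows a b ∷ μs) A = step (rowPerm A (transpose a b)) (applyAll-equivalent μs _)
applyAll-equivalent (swapCols a b ∷ μs) A = step (colPerm A (transpose a b)) (applyAll-equivalent μs _)

S₂-to-S₁ : List (Move 12 11)
S₂-to-S₁ =
  flipCol (# 5) ∷ flipCol (# 6) ∷ flipCol (# 7) ∷ flipCol (# 8) ∷ flipCol (# 9) ∷ flipCol (# 10) ∷
  swapRows (# 0) (# 1) ∷
  swapCols (# 5) (# 10) ∷ swapCols (# 6) (# 9) ∷ swapCols (# 7) (# 8) ∷ []

S₂-to-S₁-correct : applyAll S₂-to-S₁ S₂ ≋ᵇ S₁ ≡ true
S₂-to-S₁-correct = refl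

S₂~S₁ : Equivalent S₂ S₁
S₂~S₁ = ~-trans (applyAll-equivalent S₂-to-S₁ S₂)
                (done (≋ᵇ-sound (applyAll S₂-to-S₁ S₂) S₁ (≡true⇒T S₂-to-S₁-correct)))

patternOccurs : ∀ {m n} → BinMatrix m n → Fin n → Fin n → Fin n → Bool → Bool → Bool → Bool
patternOccurs A a b c x y z = existsFin λ r → A r a == x ∧ A r b == y ∧ A r c == z

allPatterns : ∀ {m n} → BinMatrix m n → Fin n → Fin n → Fin n → Bool
allPatterns A a b c = forBits λ x → forBits λ y → forBits (patternOccurs A a b c x y)

tripleCovered : ∀ {m n} → BinMatrix m n → Fin n → Fin n → Fin n → Bool
tripleCovered A a b c = isYes (a ≟ b) ∨ isYes (a ≟ c) ∨ isYes (b ≟ c) ∨ allPatterns A a b c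

covers3ᵇ : ∀ {m n} → BinMatrix m n → Bool
covers3ᵇ A = forAllFin λ a → forAllFin λ b → forAllFin (tripleCovered A a b)

drop-equation : ∀ {n} {a b : Fin n} {rest} → T (isYes (a ≟ b) ∨ rest) → ¬ a ≡ b → T rest
drop-equation ok a≢b with Equivalence.to T-∨ ok
... | inj₁ a≡b  = ⊥-elim (a≢b (toWitness a≡b))
... | inj₂ rest = rest

allPatterns-sound : ∀ {m n} (A : BinMatrix m n) {a b c} → T (allPatterns A a b c) →
  ∀ x y z → T (patternOccurs A a b c x y z)
allPatterns-sound A {a} {b} {c} all x y z =
  forBits-sound (patternOccurs A a b c x y)
    (forBits-sound (λ y → forBits (patternOccurs A a b c x y))
      (forBits-sound (λ x → forBits λ y → forBits (patternOccurs A a b c x y)) all x) y) z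

patternOccurs-sound : ∀ {m n} (A : BinMatrix m n) {a b c x y z} → T (patternOccurs A a b c x y z) →
  ∃ λ r → A r a ≡ x × A r b ≡ y × A r c ≡ z
patternOccurs-sound A {a} {b} {c} {x} {y} {z} occurs
  with existsFin-sound (λ r → A r a == x ∧ A r b == y ∧ A r c == z) occurs
... | r , hit with ∧-elim {A r a == x} hit
...   | ra , hit′ with ∧-elim {A r b == y} hit′
...     | rb , rc = r , ==-sound ra , ==-sound rb , ==-sound rc

tripleCovered-sound : ∀ {m n} (A : BinMatrix m n) {a b c} → T (tripleCovered A a b c) →
  ¬ a ≡ b → ¬ a ≡ c → ¬ b ≡ c → ∀ x y z → ∃ λ r → A r a ≡ x × A r b ≡ y × A r c ≡ z
tripleCovered-sound A ok a≢b a≢c b≢c x y z =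
  patternOccurs-sound A (allPatterns-sound A (drop-equation (drop-equation (drop-equation ok a≢b) a≢c) b≢c) x y z)

covers3ᵇ-sound : ∀ {m n} (A : BinMatrix m n) → T (covers3ᵇ A) → IsCoveringArray 3 m n A
covers3ᵇ-sound A ok = covers3-intro {A = A} λ {a} {b} {c} →
  tripleCovered-sound A (forAllFin-sound (tripleCovered A a b)
    (forAllFin-sound (λ b → forAllFin (tripleCovered A a b))
      (forAllFin-sound (λ a → forAllFin λ b → forAllFin (tripleCovered A a b)) ok a) b) c)

S₁-covering : IsCoveringArray 3 12 11 S₁
S₁-covering = covers3ᵇ-sound S₁ (≡true⇒T S₁-passes)
  where
  S₁-passes : covers3ᵇ S₁ ≡ true
  S₁-passes = refl

search-complete : search 132 zero zero emptyBoard ≡ true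
search-complete = refl

normalised-solutions : ∀ N → IsCoveringArray 3 12 11 N → Normalised N → N ≋ S₁ ⊎ N ≋ S₂
normalised-solutions N ca nf =
  search-sound N ca nf (column-weight≤6 {N} ca) 132 zero zero emptyBoard 0 search-complete
               refl (λ _ → refl) (λ r c ())

classification : ∀ A → IsCoveringArray 3 12 11 A → Equivalent A S₁
classification A caA = via (normalise A)
  where
  via : (∃ λ N → Equivalent A N × Normalised N) → Equivalent A S₁
  via (N , A~N , nf) = [ (λ N≋S₁ → ~-trans A~N (done N≋S₁))
                       , (λ N≋S₂ → ~-trans A~N (~-trans (done N≋S₂) S₂~S₁))
                       ]′ (normalised-solutions N (CA-resp-~ A~N caA) nf)

theorem5p5 : (∃ λ (A : BinMatrix 12 11) → IsCoveringArray 3 12 11 A)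
    × ((A B : BinMatrix 12 11) → IsCoveringArray 3 12 11 A → IsCoveringArray 3 12 11 B → Equivalent A B)
theorem5p5 = (S₁ , S₁-covering) , λ A B caA caB → ~-trans (classification A caA) (~-sym (classification B caB))
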